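{- For every positive integer $n$, there is a biased partition of $\mathbb{Z}^n$, i.e. a partition $\{X_i\}_{i\in[2n]}$ of $\mathbb{Z}^n$ into $2n$ sets such that every $x\in\mathbb{Z}^n$ has exactly one neighbour in $X_i$ for each $i\in[2n]$.
   Context: $[k]=\{1,\dots,k\}$. $\mathbb{Z}^n$ is regarded as the graph with edges $\{x,x+e_i\}$ for $x\in\mathbb{Z}^n$, $i\in[n]$, where $e_i$ is the $i$-th standard basis vector; $\Gamma(x)=\{x\pm e_i: i\in[n]\}$ is the neighbourhood of $x$. A set $X\subseteq\mathbb{Z}^n$ is $p$-biased if $|\Gamma(x)\cap X|=2pn$ for all $x\in\mathbb{Z}^n$. A partition $\{X_i\}_{i\in[2n]}$ of $\mathbb{Z}^n$ is biased if each $X_i$ is $\frac{1}{2n}$-biased. -}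

module Defs where

open import Data.Nat using (ℕ; suc; _*_)
open import Data.Integer using (ℤ; +_; _+_; _-_)
open import Data.Fin using (Fin; _≟_)
open import Data.Bool using (Bool; true; false)
open import Data.List using (List; []; _∷_; _++_; concatMap; length; filter)
open import Data.List.Base using (allFin)
open import Data.Product using (Σ; _×_; _,_)
open import Relation.Binary.PropositionalEquality using (_≡_)
open import Relation.Nullary using (yes; no)

ℤ^ : ℕ → Set
ℤ^ n = Fin n → ℤ

e : ∀ {n} → Fin n → ℤ^ n
e i j with i ≟ j
... | yes _ = + 1
... | no  _ = + 0

_⊕_ : ∀ {n} → ℤ^ n → ℤ^ n → ℤ^ n
(x ⊕ y) j = x j + y j

_⊖_ : ∀ {n} → ℤ^ n → ℤ^ n → ℤ^ n
(x ⊖ y) j = x j - y j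

-- Γ(x) = {x ± e_i : i ∈ [n]}, listed as x+e_i, x-e_i for each i.
-- These 2n points are pairwise distinct, so this list enumerates Γ(x)
-- without repetition.
Γ : ∀ {n} → ℤ^ n → List (ℤ^ n)
Γ x = concatMap (λ i → (x ⊕ e i) ∷ (x ⊖ e i) ∷ []) (allFin _)

-- A partition {X_i}_{i ∈ [2n]} of ℤ^n, represented by the map assigning to
-- each point the unique index of the part containing it.
Partition : ℕ → Set
Partition n = ℤ^ n → Fin (2 * n)

neighboursIn : ∀ {n} → Partition n → ℤ^ n → Fin (2 * n) → ℕ
neighboursIn c x i = length (filter (λ y → c y ≟ i) (Γ x))

-- A set is p-biased with p = 1/(2n): |Γ(x) ∩ X_i| = 2 p n = 1 for all x.
-- The partition is biased if every part is 1/(2n)-biased.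
Biased : ∀ {n} → Partition n → Set
Biased {n} c = ∀ (x : ℤ^ n) (i : Fin (2 * n)) → neighboursIn c x i ≡ 1

module Submission where

-- Give the coordinate directions the odd weights 1, 3, …, 2n-1, let
-- L(x) = Σⱼ (2j+1)·xⱼ, and colour x by ⌊ρ(x)/2⌋ where ρ(x) = L(x) mod 4n.
-- Stepping from x along ±eᵢ changes L by ±(2i+1); modulo 4n these 2n
-- shifts are exactly the odd residues 2j+1 (0 ≤ j < 2n), each hit once,
-- with offset j = i for +eᵢ and j = 2n-1-i for −eᵢ.  Since
-- ⌊(r + 2j + 1)/2⌋ = ⌈r/2⌉ + j, the neighbour with offset j gets colour
-- (⌈ρ(x)/2⌉ + j) mod 2n, and translation mod 2n is a bijection; so every
-- colour occurs at exactly one neighbour of x.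

open import Defs
open import Data.Nat as ℕ using (ℕ; zero; suc; _≤_; _<_; _<?_; s≤s; NonZero)
open import Data.Nat.Properties as ℕ using ()
open import Data.Nat.DivMod
  using (_%_; _/_; m≡m%n+[m/n]*n; m%n<n; m%n≤n; m%n%n≡m%n; %-distribˡ-+; %-remove-+ʳ; m<n⇒m%n≡m;
         m%[n*o]/o≡m/o%n; +-distrib-/-∣ʳ; m*n/n≡m; m<n*o⇒m/o<n)
open import Data.Nat.Divisibility using (_∣_; divides)
open import Data.Integer as ℤ using (ℤ; +_; -[1+_]; _%ℕ_; _/ℕ_)
open import Data.Integer.Properties using (+-*-semiring; *-distribˡ-+; pos-+; pos-*; +-injective)
open import Data.Integer.DivMod using (a≡a%ℕn+[a/ℕn]*n; n%ℕd<d)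
open import Data.Fin using (Fin; zero; suc; _≟_; toℕ; fromℕ<; punchIn)
open import Data.Fin.Properties using (punchInᵢ≢i; toℕ-injective; toℕ-fromℕ<; toℕ<n)
open import Data.Product using (Σ; _×_; _,_)
open import Data.List using (List; []; _∷_; concat; tabulate; length; filter)
open import Data.List.Properties using (filter-accept; filter-reject; map-tabulate)
open import Data.Empty using (⊥-elim)
open import Function using (case_of_)
open import Relation.Binary.PropositionalEquality
open import Relation.Nullary using (yes; no; ¬_; contradiction)
open import Relation.Unary using (Decidable)
open import Algebra.Properties.Semiring.Sum +-*-semiring
  using (sum; sum-cong-≗; ∑-distrib-+; sum-remove; sum-replicate-zero)

data Sign : Set where
  plus minus : Sign

interleave : ∀ {A : Set} {n} → (Fin n → Sign → A) → List A
interleave h = concat (tabulate (λ i → h i plus ∷ h i minus ∷ []))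

record ExactlyOne {n} (P : Fin n → Sign → Set) : Set where
  constructor exactlyOne
  field
    index  : Fin n
    sign   : Sign
    holds  : P index sign
    unique : ∀ i s → P i s → (i , s) ≡ (index , sign)

module Counting {A : Set} {P : A → Set} (P? : Decidable P) where

  count : List A → ℕ
  count xs = length (filter P? xs)

  count-accept : ∀ {x} xs → P x → count (x ∷ xs) ≡ suc (count xs)
  count-accept xs p = cong length (filter-accept P? {xs = xs} p)

  count-reject : ∀ {x} xs → ¬ P x → count (x ∷ xs) ≡ count xs
  count-reject xs ¬p = cong length (filter-reject P? {xs = xs} ¬p)

  count-none : ∀ {n} (h : Fin n → Sign → A) → (∀ i s → ¬ P (h i s)) → count (interleave h) ≡ 0
  count-none {zero}  h none = refl
  count-none {suc n} h none = begin
    count (h zero plus ∷ h zero minus ∷ rest)  ≡⟨ count-reject _ (none zero plus) ⟩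
    count (h zero minus ∷ rest)                ≡⟨ count-reject _ (none zero minus) ⟩
    count rest                                 ≡⟨ count-none (λ i → h (suc i)) (λ i → none (suc i)) ⟩
    0                                          ∎
    where
    open ≡-Reasoning
    rest = interleave (λ i → h (suc i))

  count-one : ∀ {n} (h : Fin n → Sign → A) → ExactlyOne (λ i s → P (h i s)) → count (interleave h) ≡ 1
  count-one {suc n} h (exactlyOne zero plus p unique) = begin
    count (h zero plus ∷ h zero minus ∷ rest)  ≡⟨ count-accept _ p ⟩
    suc (count (h zero minus ∷ rest))          ≡⟨ cong suc (count-reject _ (λ q → case unique zero minus q of λ ())) ⟩
    suc (count rest)                           ≡⟨ cong suc (count-none _ (λ i s q → case unique (suc i) s q of λ ())) ⟩
    1                                          ∎
    where
    open ≡-Reasoning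
    rest = interleave (λ i → h (suc i))
  count-one {suc n} h (exactlyOne zero minus p unique) = begin
    count (h zero plus ∷ h zero minus ∷ rest)  ≡⟨ count-reject _ (λ q → case unique zero plus q of λ ()) ⟩
    count (h zero minus ∷ rest)                ≡⟨ count-accept _ p ⟩
    suc (count rest)                           ≡⟨ cong suc (count-none _ (λ i s q → case unique (suc i) s q of λ ())) ⟩
    1                                          ∎
    where
    open ≡-Reasoning
    rest = interleave (λ i → h (suc i))
  count-one {suc n} h (exactlyOne (suc k) s p unique) = begin
    count (h zero plus ∷ h zero minus ∷ rest)  ≡⟨ count-reject _ (λ q → case unique zero plus q of λ ()) ⟩
    count (h zero minus ∷ rest)                ≡⟨ count-reject _ (λ q → case unique zero minus q of λ ()) ⟩
    count rest                                 ≡⟨ count-one _ (exactlyOne k s p unique′) ⟩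
    1                                          ∎
    where
    open ≡-Reasoning
    rest = interleave (λ i → h (suc i))
    unique′ : ∀ i s′ → P (h (suc i) s′) → (i , s′) ≡ (k , s)
    unique′ i s′ q with unique (suc i) s′ q
    ... | refl = refl

module _ where
  open import Data.Integer using (_+_; _-_; _*_; -_)
  open import Data.Integer.Tactic.RingSolver using (solve-∀)

  e-diag : ∀ {n} (i : Fin n) → e i i ≡ + 1
  e-diag i with i ≟ i
  ... | yes _   = refl
  ... | no i≢i = contradiction refl i≢i

  e-off : ∀ {n} {i j : Fin n} → ¬ i ≡ j → e i j ≡ + 0
  e-off {i = i} {j} i≢j with i ≟ j
  ... | yes i≡j = contradiction i≡j i≢j
  ... | no _    = refl

  pairing : ∀ {n} → (Fin n → ℤ) → ℤ^ n → ℤ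
  pairing w x = sum (λ j → w j * x j)

  pairing-cong : ∀ {n} (w : Fin n → ℤ) {x y : ℤ^ n} → (∀ j → x j ≡ y j) → pairing w x ≡ pairing w y
  pairing-cong w x≗y = sum-cong-≗ (λ j → cong (w _ *_) (x≗y j))

  pairing-⊕ : ∀ {n} (w : Fin n → ℤ) (x y : ℤ^ n) → pairing w (x ⊕ y) ≡ pairing w x + pairing w y
  pairing-⊕ w x y =
    trans (sum-cong-≗ (λ j → *-distribˡ-+ (w j) (x j) (y j)))
          (∑-distrib-+ (λ j → w j * x j) (λ j → w j * y j))

  pairing-e : ∀ {n} (w : Fin n → ℤ) (i : Fin n) → pairing w (e i) ≡ w i
  pairing-e {suc n} w i = begin
    pairing w (e i)
      ≡⟨ sum-remove {i = i} (λ j → w j * e i j) ⟩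
    w i * e i i + sum (λ j → w (punchIn i j) * e i (punchIn i j))
      ≡⟨ cong₂ _+_ (cong (w i *_) (e-diag i)) (trans (sum-cong-≗ off-diagonal) (sum-replicate-zero n)) ⟩
    w i * + 1 + + 0
      ≡⟨ unit (w i) ⟩
    w i ∎
    where
    open ≡-Reasoning
    off-diagonal : ∀ j → w (punchIn i j) * e i (punchIn i j) ≡ + 0
    off-diagonal j =
      trans (cong (w (punchIn i j) *_) (e-off (λ i≡ → punchInᵢ≢i i j (sym i≡)))) (times-zero (w (punchIn i j)))
      where
      times-zero : ∀ a → a * + 0 ≡ + 0
      times-zero = solve-∀
    unit : ∀ a → a * + 1 + + 0 ≡ a
    unit = solve-∀

  -- A step along −eᵢ lowers ⟨w, ·⟩ by wᵢ, since stepping back along +eᵢ undoes it.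
  pairing-⊖e : ∀ {n} (w : Fin n → ℤ) (x : ℤ^ n) (i : Fin n) → pairing w (x ⊖ e i) ≡ pairing w x - w i
  pairing-⊖e w x i = begin
    pairing w (x ⊖ e i)                  ≡⟨ cancel (pairing w (x ⊖ e i)) (w i) ⟩
    (pairing w (x ⊖ e i) + w i) - w i    ≡⟨ cong (_- w i) restore ⟩
    pairing w x - w i                    ∎
    where
    open ≡-Reasoning
    cancel : ∀ a b → a ≡ (a + b) - b
    cancel = solve-∀
    sub-add : ∀ a b → a - b + b ≡ a
    sub-add = solve-∀
    restore : pairing w (x ⊖ e i) + w i ≡ pairing w x
    restore = begin
      pairing w (x ⊖ e i) + w i                ≡⟨ cong (λ c → pairing w (x ⊖ e i) + c) (pairing-e w i) ⟨
      pairing w (x ⊖ e i) + pairing w (e i)    ≡⟨ pairing-⊕ w (x ⊖ e i) (e i) ⟨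
      pairing w ((x ⊖ e i) ⊕ e i)              ≡⟨ pairing-cong w (λ j → sub-add (x j) (e i j)) ⟩
      pairing w x                              ∎

  no-positive-shift : ∀ {K a} b k → a < K → ¬ (+ a ≡ + b + + suc k * + K)
  no-positive-shift {K} {a} b k a<K a≡ = ℕ.<⇒≱ a<K (begin
    K                   ≤⟨ ℕ.m≤n*m K (suc k) ⟩
    suc k ℕ.* K         ≤⟨ ℕ.m≤n+m _ b ⟩
    b ℕ.+ suc k ℕ.* K   ≡⟨ +-injective in-ℕ ⟨
    a                   ∎)
    where
    open ℕ.≤-Reasoning
    in-ℕ : + a ≡ + (b ℕ.+ suc k ℕ.* K)
    in-ℕ = trans a≡ (trans (cong (_+_ (+ b)) (sym (pos-* (suc k) K))) (sym (pos-+ b _)))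

  residue-unique : ∀ {K a b} (p q : ℤ) → a < K → b < K → + a + p * + K ≡ + b + q * + K → a ≡ b
  residue-unique {K} {a} {b} p q a<K b<K same = by-difference (q - p) (move same)
    where
    move : + a + p * + K ≡ + b + q * + K → + a ≡ + b + (q - p) * + K
    move eq = trans (add-sub (+ a) p (+ K)) (trans (cong (_- p * + K) eq) (collect (+ b) p q (+ K)))
      where
      add-sub : ∀ A P K → A ≡ (A + P * K) - P * K
      add-sub = solve-∀
      collect : ∀ B P Q K → (B + Q * K) - P * K ≡ B + (Q - P) * K
      collect = solve-∀
    flip : ∀ d → + a ≡ + b + d * + K → + b ≡ + a + (- d) * + K
    flip d eq = trans (undo (+ b) d (+ K)) (cong (λ z → z + (- d) * + K) (sym eq))
      where
      undo : ∀ B D K → B ≡ (B + D * K) + (- D) * K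
      undo = solve-∀
    by-difference : ∀ d → + a ≡ + b + d * + K → a ≡ b
    by-difference (+ zero)  eq = +-injective (trans eq (no-shift (+ b) (+ K)))
      where
      no-shift : ∀ B K → B + + 0 * K ≡ B
      no-shift = solve-∀
    by-difference (+ suc k) eq = ⊥-elim (no-positive-shift b k a<K eq)
    by-difference -[1+ k ]  eq = ⊥-elim (no-positive-shift a k b<K (flip -[1+ k ] eq))

  residue-of : ∀ K .{{_ : NonZero K}} (z : ℤ) (r : ℕ) (q : ℤ) → z ≡ + r + q * + K → z %ℕ K ≡ r % K
  residue-of K z r q z≡ = residue-unique (z /ℕ K) (+ (r / K) + q) (n%ℕd<d z K) (m%n<n r K) (begin
    + (z %ℕ K) + (z /ℕ K) * + K           ≡⟨ a≡a%ℕn+[a/ℕn]*n z K ⟨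
    z                                     ≡⟨ z≡ ⟩
    + r + q * + K                         ≡⟨ cong (λ c → + c + q * + K) (m≡m%n+[m/n]*n r K) ⟩
    + (r % K ℕ.+ r / K ℕ.* K) + q * + K
      ≡⟨ cong (_+ q * + K) (trans (pos-+ (r % K) _) (cong (_+_ (+ (r % K))) (pos-* (r / K) K))) ⟩
    + (r % K) + + (r / K) * + K + q * + K ≡⟨ regroup (+ (r % K)) (+ (r / K)) q (+ K) ⟩
    + (r % K) + (+ (r / K) + q) * + K     ∎)
    where
    open ≡-Reasoning
    regroup : ∀ R S Q K → R + S * K + Q * K ≡ R + (S + Q) * K
    regroup = solve-∀

  residue-+ : ∀ K .{{_ : NonZero K}} (z : ℤ) (k : ℕ) → (z + + k) %ℕ K ≡ (z %ℕ K ℕ.+ k) % K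
  residue-+ K z k = residue-of K (z + + k) (z %ℕ K ℕ.+ k) (z /ℕ K) (begin
    z + + k                              ≡⟨ cong (_+ + k) (a≡a%ℕn+[a/ℕn]*n z K) ⟩
    + (z %ℕ K) + (z /ℕ K) * + K + + k    ≡⟨ swap (+ (z %ℕ K)) (z /ℕ K) (+ K) (+ k) ⟩
    + (z %ℕ K) + + k + (z /ℕ K) * + K    ≡⟨ cong (_+ (z /ℕ K) * + K) (pos-+ (z %ℕ K) k) ⟨
    + (z %ℕ K ℕ.+ k) + (z /ℕ K) * + K    ∎)
    where
    open ≡-Reasoning
    swap : ∀ R Q K k → R + Q * K + k ≡ R + k + Q * K
    swap = solve-∀

  residue-- : ∀ K .{{_ : NonZero K}} (z : ℤ) (k j : ℕ) → k ℕ.+ j ≡ K → (z - + k) %ℕ K ≡ (z %ℕ K ℕ.+ j) % K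
  residue-- K z k j k+j≡K = residue-of K (z - + k) (z %ℕ K ℕ.+ j) (z /ℕ K - + 1) (begin
    z - + k                                       ≡⟨ cong (_- + k) (a≡a%ℕn+[a/ℕn]*n z K) ⟩
    + (z %ℕ K) + (z /ℕ K) * + K - + k             ≡⟨ cong (λ c → + (z %ℕ K) + (z /ℕ K) * c - + k) K≡ ⟩
    + (z %ℕ K) + (z /ℕ K) * (+ k + + j) - + k     ≡⟨ wrap (+ (z %ℕ K)) (z /ℕ K) (+ k) (+ j) ⟩
    + (z %ℕ K) + + j + (z /ℕ K - + 1) * (+ k + + j)
      ≡⟨ cong₂ (λ a c → a + (z /ℕ K - + 1) * c) (pos-+ (z %ℕ K) j) K≡ ⟨
    + (z %ℕ K ℕ.+ j) + (z /ℕ K - + 1) * + K       ∎)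
    where
    open ≡-Reasoning
    K≡ : + K ≡ + k + + j
    K≡ = trans (cong +_ (sym k+j≡K)) (pos-+ k j)
    wrap : ∀ R Q k j → R + Q * (k + j) - k ≡ R + j + (Q - + 1) * (k + j)
    wrap = solve-∀

module _ where
  open import Data.Nat using (_+_; _*_; _∸_)
  open import Data.Nat.Tactic.RingSolver using (solve-∀)

  halve-odd-shift : ∀ N .{{_ : NonZero N}} {{_ : NonZero (N * 2)}} r j →
                    ((r + suc (j * 2)) % (N * 2)) / 2 ≡ (suc r / 2 + j) % N
  halve-odd-shift N r j = begin
    ((r + suc (j * 2)) % (N * 2)) / 2   ≡⟨ m%[n*o]/o≡m/o%n (r + suc (j * 2)) N 2 ⟩
    ((r + suc (j * 2)) / 2) % N         ≡⟨ cong (λ c → (c / 2) % N) (ℕ.+-suc r (j * 2)) ⟩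
    ((suc r + j * 2) / 2) % N           ≡⟨ cong (_% N) (+-distrib-/-∣ʳ (suc r) (divides j refl)) ⟩
    (suc r / 2 + j * 2 / 2) % N         ≡⟨ cong (λ c → (suc r / 2 + c) % N) (m*n/n≡m j 2) ⟩
    (suc r / 2 + j) % N                 ∎
    where open ≡-Reasoning

  -- Translation j ↦ (a + j) mod N is a bijection of {0, …, N-1}; its
  -- inverse adds the complement N − (a mod N).
  module Translation (N : ℕ) .{{_ : NonZero N}} where

    complement : ℕ → ℕ
    complement a = N ∸ a % N

    complement-cancels : ∀ a → N ∣ a + complement a
    complement-cancels a = divides (suc (a / N)) (begin
      a + (N ∸ a % N)                   ≡⟨ cong (_+ (N ∸ a % N)) (m≡m%n+[m/n]*n a N) ⟩
      a % N + a / N * N + (N ∸ a % N)   ≡⟨ regroup (a % N) (a / N * N) (N ∸ a % N) ⟩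
      a % N + (N ∸ a % N) + a / N * N   ≡⟨ cong (_+ a / N * N) (ℕ.m+[n∸m]≡n (m%n≤n a N)) ⟩
      suc (a / N) * N                   ∎)
      where
      open ≡-Reasoning
      regroup : ∀ r x c → r + x + c ≡ r + c + x
      regroup = solve-∀

    %-cong-+ : ∀ {x y} c → x % N ≡ y % N → (x + c) % N ≡ (y + c) % N
    %-cong-+ {x} {y} c x≡y = begin
      (x + c) % N           ≡⟨ %-distribˡ-+ x c N ⟩
      (x % N + c % N) % N   ≡⟨ cong (λ r → (r + c % N) % N) x≡y ⟩
      (y % N + c % N) % N   ≡⟨ %-distribˡ-+ y c N ⟨
      (y + c) % N           ∎
      where open ≡-Reasoning

    shift-back : ∀ a y → (a + (y + complement a)) % N ≡ y % N
    shift-back a y = begin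
      (a + (y + complement a)) % N   ≡⟨ cong (_% N) (ℕ.+-comm a _) ⟩
      (y + complement a + a) % N     ≡⟨ cong (_% N) (ℕ.+-assoc y _ a) ⟩
      (y + (complement a + a)) % N   ≡⟨ %-remove-+ʳ y (subst (N ∣_) (ℕ.+-comm a _) (complement-cancels a)) ⟩
      y % N                          ∎
      where open ≡-Reasoning

    recover : ∀ a {j} → j < N → (a + j + complement a) % N ≡ j
    recover a {j} j<N = begin
      (a + j + complement a) % N     ≡⟨ cong (_% N) (ℕ.+-assoc a j _) ⟩
      (a + (j + complement a)) % N   ≡⟨ shift-back a j ⟩
      j % N                          ≡⟨ m<n⇒m%n≡m j<N ⟩
      j                              ∎
      where open ≡-Reasoning

    translate-injective : ∀ a {j j′} → j < N → j′ < N → (a + j) % N ≡ (a + j′) % N → j ≡ j′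
    translate-injective a {j} {j′} j<N j′<N same = begin
      j                              ≡⟨ recover a j<N ⟨
      (a + j + complement a) % N     ≡⟨ %-cong-+ (complement a) same ⟩
      (a + j′ + complement a) % N    ≡⟨ recover a j′<N ⟩
      j′                             ∎
      where open ≡-Reasoning

    translate-surjective : ∀ a {t} → t < N → Σ ℕ λ j → j < N × (a + j) % N ≡ t
    translate-surjective a {t} t<N = j , m%n<n _ N , (begin
      (a + (t + complement a) % N) % N   ≡⟨ cong (_% N) (ℕ.+-comm a _) ⟩
      ((t + complement a) % N + a) % N   ≡⟨ %-cong-+ a (m%n%n≡m%n _ N) ⟩
      (t + complement a + a) % N         ≡⟨ cong (_% N) (ℕ.+-comm _ a) ⟩
      (a + (t + complement a)) % N       ≡⟨ shift-back a t ⟩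
      t % N                              ≡⟨ m<n⇒m%n≡m t<N ⟩
      t                                  ∎)
      where
      open ≡-Reasoning
      j = (t + complement a) % N

  mirror-involutive : ∀ {N x} → x < N → N ∸ suc (N ∸ suc x) ≡ x
  mirror-involutive (s≤s x≤P) = ℕ.m∸[m∸n]≡n x≤P

  -- 2 * n unfolds to n + (n + 0); the offsets are easier to bound via n + n.
  double : ∀ n → 2 * n ≡ n + n
  double n = cong (_+_ n) (ℕ.+-identityʳ n)

  offset : ∀ {n} → Fin n → Sign → ℕ
  offset     i plus  = toℕ i
  offset {n} i minus = 2 * n ∸ suc (toℕ i)

  offset-< : ∀ {n} (i : Fin n) s → offset i s < 2 * n
  offset-< {n}     i plus  = ℕ.≤-trans (toℕ<n i) (ℕ.m≤m+n n _)
  offset-< {suc n} i minus = s≤s (ℕ.m∸n≤m _ (toℕ i))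

  minus-high : ∀ {n} (i : Fin n) → n ≤ offset i minus
  minus-high {n} i = begin
    n                        ≤⟨ ℕ.m≤m+n n _ ⟩
    n + (n ∸ suc (toℕ i))    ≡⟨ ℕ.+-∸-assoc n (toℕ<n i) ⟨
    n + n ∸ suc (toℕ i)      ≡⟨ cong (_∸ suc (toℕ i)) (double n) ⟨
    2 * n ∸ suc (toℕ i)      ∎
    where open ℕ.≤-Reasoning

  offset-exactlyOne : ∀ {n j} → j < 2 * n → ExactlyOne (λ (i : Fin n) s → offset i s ≡ j)
  offset-exactlyOne {zero} ()
  offset-exactlyOne {n@(suc _)} {j} j<2n with j <? n
  ... | yes j<n = exactlyOne (fromℕ< j<n) plus (toℕ-fromℕ< j<n) unique
    where
    unique : ∀ i s → offset i s ≡ j → (i , s) ≡ (fromℕ< j<n , plus)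
    unique i plus  eq = cong (_, plus) (toℕ-injective (trans eq (sym (toℕ-fromℕ< j<n))))
    unique i minus eq = contradiction (subst (n ≤_) eq (minus-high i)) (ℕ.<⇒≱ j<n)
  ... | no j≮n = exactlyOne (fromℕ< mirror<n) minus holds unique
    where
    n≤j = ℕ.≮⇒≥ j≮n
    mirror<n : 2 * n ∸ suc j < n
    mirror<n = ℕ.m<n+o⇒m∸n<o (2 * n) (suc j) (begin-strict
      2 * n        ≡⟨ double n ⟩
      n + n        <⟨ ℕ.+-monoˡ-< n (s≤s n≤j) ⟩
      suc j + n    ∎)
      where open ℕ.≤-Reasoning
    holds : 2 * n ∸ suc (toℕ (fromℕ< mirror<n)) ≡ j
    holds = trans (cong (λ k → 2 * n ∸ suc k) (toℕ-fromℕ< mirror<n)) (mirror-involutive j<2n)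
    unique : ∀ i s → offset i s ≡ j → (i , s) ≡ (fromℕ< mirror<n , minus)
    unique i plus  eq = contradiction (subst (_< n) eq (toℕ<n i)) (ℕ.≤⇒≯ n≤j)
    unique i minus eq = cong (_, minus) (toℕ-injective (begin
      toℕ i                          ≡⟨ mirror-involutive (offset-< i plus) ⟨
      2 * n ∸ suc (offset i minus)   ≡⟨ cong (λ k → 2 * n ∸ suc k) eq ⟩
      2 * n ∸ suc j                  ≡⟨ toℕ-fromℕ< mirror<n ⟨
      toℕ (fromℕ< mirror<n)          ∎))
      where open ≡-Reasoning

module Colouring (n : ℕ) .{{_ : NonZero n}} where
  open import Data.Nat using (_+_; _*_)
  open import Data.Nat.Tactic.RingSolver using (solve-∀)

  N K : ℕ
  N = 2 * n
  K = N * 2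

  instance
    N-nonZero : NonZero N
    N-nonZero = ℕ.m*n≢0 2 n
    K-nonZero : NonZero K
    K-nonZero = ℕ.m*n≢0 N 2

  open Translation N

  weight : Fin n → ℤ
  weight j = + suc (toℕ j * 2)

  level : ℤ^ n → ℕ
  level x = pairing weight x %ℕ K

  colour : Partition n
  colour x = fromℕ< (m<n*o⇒m/o<n (n%ℕd<d (pairing weight x) K))

  step : ℤ^ n → Fin n → Sign → ℤ^ n
  step x i plus  = x ⊕ e i
  step x i minus = x ⊖ e i

  Γ-interleave : ∀ x → Γ x ≡ interleave (step x)
  Γ-interleave x = cong concat (map-tabulate (λ i → i) (λ i → (x ⊕ e i) ∷ (x ⊖ e i) ∷ []))

  level-step : ∀ x i s → level (step x i s) ≡ (level x + suc (offset i s * 2)) % K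
  level-step x i plus = begin
    pairing weight (x ⊕ e i) %ℕ K                   ≡⟨ cong (_%ℕ K) (pairing-⊕ weight x (e i)) ⟩
    (pairing weight x ℤ.+ pairing weight (e i)) %ℕ K ≡⟨ cong (λ c → (pairing weight x ℤ.+ c) %ℕ K) (pairing-e weight i) ⟩
    (pairing weight x ℤ.+ weight i) %ℕ K            ≡⟨ residue-+ K (pairing weight x) (suc (toℕ i * 2)) ⟩
    (level x + suc (toℕ i * 2)) % K                 ∎
    where open ≡-Reasoning
  level-step x i minus = begin
    pairing weight (x ⊖ e i) %ℕ K                   ≡⟨ cong (_%ℕ K) (pairing-⊖e weight x i) ⟩
    (pairing weight x ℤ.- weight i) %ℕ K            ≡⟨ residue-- K (pairing weight x) _ _ weights-sum ⟩
    (level x + suc (offset i minus * 2)) % K        ∎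
    where
    open ≡-Reasoning
    split : ∀ a b → (suc a + b) * 2 ≡ suc (a * 2) + suc (b * 2)
    split = solve-∀
    weights-sum : suc (toℕ i * 2) + suc (offset i minus * 2) ≡ K
    weights-sum = trans (sym (split (toℕ i) (offset i minus))) (cong (_* 2) (ℕ.m+[n∸m]≡n (offset-< i plus)))

  colour-step : ∀ x i s → toℕ (colour (step x i s)) ≡ (suc (level x) / 2 + offset i s) % N
  colour-step x i s = begin
    toℕ (colour (step x i s))                       ≡⟨ toℕ-fromℕ< _ ⟩
    level (step x i s) / 2                          ≡⟨ cong (_/ 2) (level-step x i s) ⟩
    ((level x + suc (offset i s * 2)) % K) / 2      ≡⟨ halve-odd-shift N (level x) (offset i s) ⟩
    (suc (level x) / 2 + offset i s) % N            ∎
    where open ≡-Reasoning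

  colour-exactlyOne : ∀ x t → ExactlyOne (λ i s → colour (step x i s) ≡ t)
  colour-exactlyOne x t with translate-surjective (suc (level x) / 2) (toℕ<n t)
  ... | j , j<N , hits-t with offset-exactlyOne j<N
  ...   | exactlyOne i₀ s₀ offset≡j unique = exactlyOne i₀ s₀ holds unique′
    where
    a = suc (level x) / 2
    holds : colour (step x i₀ s₀) ≡ t
    holds = toℕ-injective (trans (colour-step x i₀ s₀) (trans (cong (λ k → (a + k) % N) offset≡j) hits-t))
    unique′ : ∀ i s → colour (step x i s) ≡ t → (i , s) ≡ (i₀ , s₀)
    unique′ i s hit = unique i s (translate-injective a (offset-< i s) j<N
      (trans (sym (colour-step x i s)) (trans (cong toℕ hit) (sym hits-t))))

  biased : Biased colour
  biased x t = begin
    neighboursIn colour x t             ≡⟨ cong count (Γ-interleave x) ⟩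
    count (interleave (step x))         ≡⟨ count-one (step x) (colour-exactlyOne x t) ⟩
    1                                   ∎
    where
    open ≡-Reasoning
    open Counting (λ y → colour y ≟ t)

theorem3p1 : (n : ℕ) → 1 ≤ n → Σ (Partition n) Biased
theorem3p1 n@(suc _) _ = colour , biased
  where open Colouring n
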